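{- For integers $n\geq 2$ and $k\geq 1$, let $HM_{n,k}$ be the number of pairs $(M,P)$ where $M$ is a Motzkin path of order $n$ and $P$ is a hump of $M$ of height $k$, and let $SM_{n,k}$ be the number of free Motzkin paths of order $n$ whose smallest $y$-coordinate is $-k$ and whose last non-flat step is an up step $U$. Then $HM_{n,k}=SM_{n,k}$.
   Context: A Motzkin path of order $n$ is a lattice path from $(0,0)$ to $(n,0)$ using up steps $U=(1,1)$, down steps $D=(1,-1)$ and flat steps $F=(1,0)$ that never goes below the $x$-axis; a free Motzkin path of order $n$ is such a lattice path from $(0,0)$ to $(n,0)$ that is allowed to go below the $x$-axis. A hump in a Motzkin path is a consecutive sequence of steps consisting of an up step, followed by zero or more flat steps, followed by a down step. The height of a hump is the $y$-coordinate reached by the up step of the hump. -}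

module Defs where

open import Data.Nat using (ℕ; zero; suc; _+_)
open import Data.Integer as ℤ using (ℤ; +_; -_; _⊓_)
open import Data.List using (List; []; _∷_; concatMap; map; length; filterᵇ)
open import Data.Nat.ListAction using (sum)
open import Data.Bool using (Bool; true; false; _∧_; _∨_; not; if_then_else_)
open import Relation.Nullary.Decidable using (⌊_⌋)
open import Relation.Binary.PropositionalEquality using (_≡_)

-- Steps of a lattice path: U = (1,1), D = (1,-1), F = (1,0).
data Step : Set where
  U D F : Step

δ : Step → ℤ
δ U = + 1
δ D = ℤ.-[1+ 0 ]
δ F = + 0

words : ℕ → List (List Step)
words zero    = [] ∷ []
words (suc n) = concatMap (λ w → (U ∷ w) ∷ (D ∷ w) ∷ (F ∷ w) ∷ []) (words n)

endHeight : ℤ → List Step → ℤ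
endHeight h []       = h
endHeight h (s ∷ ss) = endHeight (h ℤ.+ δ s) ss

staysNonNeg : ℤ → List Step → Bool
staysNonNeg h []       = ⌊ + 0 ℤ.≤? h ⌋
staysNonNeg h (s ∷ ss) = ⌊ + 0 ℤ.≤? h ⌋ ∧ staysNonNeg (h ℤ.+ δ s) ss

minHeight : ℤ → List Step → ℤ
minHeight h []       = h
minHeight h (s ∷ ss) = h ⊓ minHeight (h ℤ.+ δ s) ss

isMotzkin : List Step → Bool
isMotzkin w = ⌊ endHeight (+ 0) w ℤ.≟ + 0 ⌋ ∧ staysNonNeg (+ 0) w

isFreeMotzkin : List Step → Bool
isFreeMotzkin w = ⌊ endHeight (+ 0) w ℤ.≟ + 0 ⌋

flatsThenDown : List Step → Bool
flatsThenDown (D ∷ _)  = true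
flatsThenDown (F ∷ ss) = flatsThenDown ss
flatsThenDown _        = false

-- A hump is a consecutive factor U F^j D (j ≥ 0); it is determined by the
-- position of its up step, and its height is the y-coordinate reached by
-- that up step.
humpsOfHeight : ℤ → ℤ → List Step → ℕ
humpsOfHeight k h []       = 0
humpsOfHeight k h (U ∷ ss) =
  (if ⌊ h ℤ.+ + 1 ℤ.≟ k ⌋ ∧ flatsThenDown ss then 1 else 0)
  + humpsOfHeight k (h ℤ.+ + 1) ss
humpsOfHeight k h (s ∷ ss) = humpsOfHeight k (h ℤ.+ δ s) ss

lastNonFlatIsUp : List Step → Bool
lastNonFlatIsUp []       = false
lastNonFlatIsUp (U ∷ ss) = lastNonFlatIsUp ss ∨ allFlat ss
  where
  allFlat : List Step → Bool
  allFlat []       = true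
  allFlat (F ∷ ts) = allFlat ts
  allFlat (_ ∷ _)  = false
lastNonFlatIsUp (_ ∷ ss) = lastNonFlatIsUp ss

HM : ℕ → ℕ → ℕ
HM n k = sum (map (humpsOfHeight (+ k) (+ 0)) (filterᵇ isMotzkin (words n)))

SM : ℕ → ℕ → ℕ
SM n k = length (filterᵇ (λ w → isFreeMotzkin w ∧ ⌊ minHeight (+ 0) w ℤ.≟ - (+ k) ⌋ ∧ lastNonFlatIsUp w) (words n))

{-# OPTIONS --safe #-}
module Submission where

-- At the up step of the hump, a Motzkin path with a marked hump of height k splits into a walk
-- from 0 to k − 1 inside ℤ≥0, the steps U Fʲ D, and a walk from k − 1 to 0 inside ℤ≥0.  At its
-- first visit to −k and at its last up step, a free Motzkin path with minimum −k whose last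
-- non-flat step is U splits into a walk from 0 to 1 − k staying above −k, a step D, a walk from
-- −k to −1 staying weakly above −k, and the steps U Fʲ.  Translating by k − 1 and by k turns the
-- last two kinds of walks into the first two, so if P a and Q b count the walks of length a from
-- 0 to k − 1 and of length b from k − 1 to 0 inside ℤ≥0, both numbers equal
-- Σ_{a + b + j + 2 = n} P a * Q b.  As convolutions, HM = P ⋆ (Q ⋆ 1) and SM = Q ⋆ (P ⋆ 1).

open import Algebra.Bundles using (AbelianGroup; CommutativeMonoid)
open import Data.Bool using (Bool; true; false; _∧_; _∨_; if_then_else_)
open import Data.Bool.Properties using (∧-comm; ∧-assoc; ∧-zeroʳ; ∧-idem; ∨-identityʳ; ∧-commutativeMonoid)
open import Data.Empty using (⊥-elim)
open import Data.Integer as ℤ using (ℤ; 0ℤ; 1ℤ; _⊓_)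
import Data.Integer.Properties as ℤ
import Data.Integer.Tactic.RingSolver as ℤ
open import Data.List using (List; []; _∷_; map; length; filterᵇ; concatMap; replicate)
open import Data.List.Properties using (map-cong)
open import Data.Nat using (ℕ; zero; suc; _+_; _*_; _≤_)
open import Data.Nat.ListAction using (sum)
open import Data.Nat.Properties
  using (+-identityʳ; *-identityˡ; *-identityʳ; *-zeroʳ; *-distribˡ-+; *-distribʳ-+; *-assoc; *-comm; +-commutativeSemigroup)
open import Data.Nat.Tactic.RingSolver using (solve-∀)
open import Data.Product using (_×_; _,_; proj₂; uncurry)
open import Data.Sum using (inj₁; inj₂)
open import Defs
open import Function using (_∘_; const)
open import Function.Bundles using (_⇔_; mk⇔)
open import Relation.Binary.PropositionalEquality
open import Relation.Nullary.Decidable using (Dec; yes; no; ⌊_⌋; _×-dec_; isYes≗does; does-⇔; dec-true; dec-false)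
open import Relation.Nullary.Negation using (¬_)
open ≡-Reasoning

open import Algebra.Properties.CommutativeSemigroup (CommutativeMonoid.commutativeSemigroup ∧-commutativeMonoid)
  using () renaming (x∙yz≈y∙xz to ∧-leftComm)
open import Algebra.Properties.CommutativeSemigroup +-commutativeSemigroup
  using () renaming (interchange to +-interchange)
open import Algebra.Properties.Group (AbelianGroup.group ℤ.+-0-abelianGroup)
  using () renaming (∙-cancelʳ to +-cancelʳ-≡)

𝟙 : Bool → ℕ
𝟙 b = if b then 1 else 0

𝟙-∧ : ∀ a b → 𝟙 (a ∧ b) ≡ 𝟙 a * 𝟙 b
𝟙-∧ true  b = sym (+-identityʳ (𝟙 b))
𝟙-∧ false b = refl

𝟙-∧-* : ∀ a b n → 𝟙 (a ∧ b) * n ≡ 𝟙 a * (𝟙 b * n)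
𝟙-∧-* a b n = trans (cong (_* n) (𝟙-∧ a b)) (*-assoc (𝟙 a) (𝟙 b) n)

module _ {A : Set} where

  sum-map-cong : {f g : A → ℕ} → f ≗ g → ∀ xs → sum (map f xs) ≡ sum (map g xs)
  sum-map-cong f≗g xs = cong sum (map-cong f≗g xs)

  sum-map-0 : ∀ (xs : List A) → sum (map (const 0) xs) ≡ 0
  sum-map-0 []       = refl
  sum-map-0 (x ∷ xs) = sum-map-0 xs

  sum-map-+ : ∀ (f g : A → ℕ) xs → sum (map (λ x → f x + g x) xs) ≡ sum (map f xs) + sum (map g xs)
  sum-map-+ f g []       = refl
  sum-map-+ f g (x ∷ xs) = begin
    f x + g x + sum (map (λ x → f x + g x) xs) ≡⟨ cong (λ z → f x + g x + z) (sum-map-+ f g xs) ⟩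
    f x + g x + (sum (map f xs) + sum (map g xs)) ≡⟨ +-interchange (f x) (g x) _ _ ⟩
    f x + sum (map f xs) + (g x + sum (map g xs)) ∎

  sum-map-*ˡ : ∀ c (f : A → ℕ) xs → sum (map (λ x → c * f x) xs) ≡ c * sum (map f xs)
  sum-map-*ˡ c f []       = sym (*-zeroʳ c)
  sum-map-*ˡ c f (x ∷ xs) = begin
    c * f x + sum (map (λ x → c * f x) xs) ≡⟨ cong (c * f x +_) (sum-map-*ˡ c f xs) ⟩
    c * f x + c * sum (map f xs)           ≡⟨ *-distribˡ-+ c (f x) _ ⟨
    c * (f x + sum (map f xs))             ∎

  sum-map-filterᵇ : ∀ (p : A → Bool) (f : A → ℕ) xs →
                    sum (map f (filterᵇ p xs)) ≡ sum (map (λ x → 𝟙 (p x) * f x) xs)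
  sum-map-filterᵇ p f []       = refl
  sum-map-filterᵇ p f (x ∷ xs) with p x
  ... | true  = cong₂ _+_ (sym (*-identityˡ (f x))) (sum-map-filterᵇ p f xs)
  ... | false = sum-map-filterᵇ p f xs

  length-filterᵇ : ∀ (p : A → Bool) xs → length (filterᵇ p xs) ≡ sum (map (𝟙 ∘ p) xs)
  length-filterᵇ p []       = refl
  length-filterᵇ p (x ∷ xs) with p x
  ... | true  = cong suc (length-filterᵇ p xs)
  ... | false = length-filterᵇ p xs

Σsteps : (Step → ℕ) → ℕ
Σsteps φ = φ U + φ D + φ F

Σsteps-cong : {φ ψ : Step → ℕ} → φ ≗ ψ → Σsteps φ ≡ Σsteps ψ
Σsteps-cong φ≗ψ = cong₂ _+_ (cong₂ _+_ (φ≗ψ U) (φ≗ψ D)) (φ≗ψ F)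

Σwords : ℕ → (List Step → ℕ) → ℕ
Σwords n f = sum (map f (words n))

Σwords-suc : ∀ n f → Σwords (suc n) f ≡ Σsteps (λ s → Σwords n (f ∘ (s ∷_)))
Σwords-suc n f = go (words n)
  where
  go : ∀ ws → sum (map f (concatMap (λ w → (U ∷ w) ∷ (D ∷ w) ∷ (F ∷ w) ∷ []) ws))
            ≡ Σsteps (λ s → sum (map (f ∘ (s ∷_)) ws))
  go []       = refl
  go (w ∷ ws) = trans (cong (λ z → f (U ∷ w) + (f (D ∷ w) + (f (F ∷ w) + z))) (go ws))
                      (regroup (f (U ∷ w)) (f (D ∷ w)) (f (F ∷ w)) _ _ _)
    where
    regroup : ∀ a b c x y z → a + (b + (c + (x + y + z))) ≡ (a + x) + (b + y) + (c + z)
    regroup = solve-∀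

Σwords-suc-scaled : ∀ n c f (φ : Step → List Step → ℕ) → (∀ s w → f (s ∷ w) ≡ c * φ s w) →
                    Σwords (suc n) f ≡ c * Σsteps (λ s → Σwords n (φ s))
Σwords-suc-scaled n c f φ f≡cφ = begin
  Σwords (suc n) f                                   ≡⟨ Σwords-suc n f ⟩
  Σsteps (λ s → Σwords n (f ∘ (s ∷_)))               ≡⟨ Σsteps-cong (λ s → sum-map-cong (f≡cφ s) (words n)) ⟩
  Σsteps (λ s → Σwords n (λ w → c * φ s w))          ≡⟨ Σsteps-cong (λ s → sum-map-*ˡ c (φ s) (words n)) ⟩
  Σsteps (λ s → c * Σwords n (φ s))                  ≡⟨ factor c _ _ _ ⟩
  c * Σsteps (λ s → Σwords n (φ s))                  ∎
  where
  factor : ∀ c x y z → c * x + c * y + c * z ≡ c * (x + y + z)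
  factor = solve-∀

-- Convolution

-- (f ⋆ g) n = Σ_{a + 1 + b = n} f a * g b
infixl 7 _⋆_
_⋆_ : (ℕ → ℕ) → (ℕ → ℕ) → ℕ → ℕ
(f ⋆ g) zero    = 0
(f ⋆ g) (suc n) = f 0 * g n + ((f ∘ suc) ⋆ g) n

⋆-cong : ∀ {f f′ g g′} → f ≗ f′ → g ≗ g′ → f ⋆ g ≗ f′ ⋆ g′
⋆-cong f≗f′ g≗g′ zero    = refl
⋆-cong f≗f′ g≗g′ (suc n) = cong₂ _+_ (cong₂ _*_ (f≗f′ 0) (g≗g′ n)) (⋆-cong (f≗f′ ∘ suc) g≗g′ n)

⋆-distribʳ-+ : ∀ f f′ g n → ((λ a → f a + f′ a) ⋆ g) n ≡ (f ⋆ g) n + (f′ ⋆ g) n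
⋆-distribʳ-+ f f′ g zero    = refl
⋆-distribʳ-+ f f′ g (suc n) = begin
  (f 0 + f′ 0) * g n + ((λ a → f (suc a) + f′ (suc a)) ⋆ g) n
    ≡⟨ cong₂ _+_ (*-distribʳ-+ (g n) (f 0) (f′ 0)) (⋆-distribʳ-+ (f ∘ suc) (f′ ∘ suc) g n) ⟩
  f 0 * g n + f′ 0 * g n + (((f ∘ suc) ⋆ g) n + ((f′ ∘ suc) ⋆ g) n)
    ≡⟨ +-interchange (f 0 * g n) _ _ _ ⟩
  f 0 * g n + ((f ∘ suc) ⋆ g) n + (f′ 0 * g n + ((f′ ∘ suc) ⋆ g) n) ∎

⋆-scaleˡ : ∀ c f g n → ((λ a → c * f a) ⋆ g) n ≡ c * (f ⋆ g) n
⋆-scaleˡ c f g zero    = sym (*-zeroʳ c)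
⋆-scaleˡ c f g (suc n) = begin
  c * f 0 * g n + ((λ a → c * f (suc a)) ⋆ g) n ≡⟨ cong₂ _+_ (*-assoc c (f 0) (g n)) (⋆-scaleˡ c (f ∘ suc) g n) ⟩
  c * (f 0 * g n) + c * ((f ∘ suc) ⋆ g) n       ≡⟨ *-distribˡ-+ c _ _ ⟨
  c * (f ⋆ g) (suc n)                           ∎

⋆-Σsteps : ∀ (f : Step → ℕ → ℕ) g n → ((λ a → Σsteps (λ s → f s a)) ⋆ g) n ≡ Σsteps (λ s → (f s ⋆ g) n)
⋆-Σsteps f g n = begin
  ((λ a → f U a + f D a + f F a) ⋆ g) n              ≡⟨ ⋆-distribʳ-+ (λ a → f U a + f D a) (f F) g n ⟩
  ((λ a → f U a + f D a) ⋆ g) n + (f F ⋆ g) n        ≡⟨ cong (_+ (f F ⋆ g) n) (⋆-distribʳ-+ (f U) (f D) g n) ⟩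
  (f U ⋆ g) n + (f D ⋆ g) n + (f F ⋆ g) n            ∎

⋆-sucʳ : ∀ f g n → (f ⋆ g) (suc n) ≡ f n * g 0 + (f ⋆ (g ∘ suc)) n
⋆-sucʳ f g zero    = refl
⋆-sucʳ f g (suc n) = begin
  f 0 * g (suc n) + ((f ∘ suc) ⋆ g) (suc n)                 ≡⟨ cong (f 0 * g (suc n) +_) (⋆-sucʳ (f ∘ suc) g n) ⟩
  f 0 * g (suc n) + (f (suc n) * g 0 + ((f ∘ suc) ⋆ (g ∘ suc)) n) ≡⟨ swap (f 0 * g (suc n)) (f (suc n) * g 0) _ ⟩
  f (suc n) * g 0 + (f ⋆ (g ∘ suc)) (suc n)                 ∎
  where
  swap : ∀ a b c → a + (b + c) ≡ b + (a + c)
  swap = solve-∀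

⋆-comm : ∀ f g → f ⋆ g ≗ g ⋆ f
⋆-comm f g zero    = refl
⋆-comm f g (suc n) = begin
  f 0 * g n + ((f ∘ suc) ⋆ g) n ≡⟨ cong₂ _+_ (*-comm (f 0) (g n)) (⋆-comm (f ∘ suc) g n) ⟩
  g n * f 0 + (g ⋆ (f ∘ suc)) n ≡⟨ ⋆-sucʳ g f n ⟨
  (g ⋆ f) (suc n)               ∎

⋆-assoc : ∀ f g h → (f ⋆ g) ⋆ h ≗ f ⋆ (g ⋆ h)
⋆-assoc f g h zero    = refl
⋆-assoc f g h (suc n) = begin
  ((λ a → f 0 * g a + ((f ∘ suc) ⋆ g) a) ⋆ h) n      ≡⟨ ⋆-distribʳ-+ (λ a → f 0 * g a) ((f ∘ suc) ⋆ g) h n ⟩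
  ((λ a → f 0 * g a) ⋆ h) n + (((f ∘ suc) ⋆ g) ⋆ h) n
    ≡⟨ cong₂ _+_ (⋆-scaleˡ (f 0) g h n) (⋆-assoc (f ∘ suc) g h n) ⟩
  f 0 * (g ⋆ h) n + ((f ∘ suc) ⋆ (g ⋆ h)) n           ∎

⋆-leftComm : ∀ f g h → f ⋆ (g ⋆ h) ≗ g ⋆ (f ⋆ h)
⋆-leftComm f g h n = begin
  (f ⋆ (g ⋆ h)) n ≡⟨ ⋆-assoc f g h n ⟨
  ((f ⋆ g) ⋆ h) n ≡⟨ ⋆-cong (⋆-comm f g) (λ _ → refl) n ⟩
  ((g ⋆ f) ⋆ h) n ≡⟨ ⋆-assoc g f h n ⟩
  (g ⋆ (f ⋆ h)) n ∎

partialSums-unique : ∀ f q → f 0 ≡ 0 → (∀ n → f (suc n) ≡ q n + f n) → f ≗ q ⋆ const 1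
partialSums-unique f q f0 fsuc zero    = f0
partialSums-unique f q f0 fsuc (suc n) = begin
  f (suc n)                ≡⟨ fsuc n ⟩
  q n + f n                ≡⟨ cong₂ _+_ (sym (*-identityʳ (q n))) (partialSums-unique f q f0 fsuc n) ⟩
  q n * 1 + (q ⋆ const 1) n ≡⟨ ⋆-sucʳ q (const 1) n ⟨
  (q ⋆ const 1) (suc n)    ∎

⌊⌋-⇔ : ∀ {a b} {A : Set a} {B : Set b} → A ⇔ B → (a? : Dec A) (b? : Dec B) → ⌊ a? ⌋ ≡ ⌊ b? ⌋
⌊⌋-⇔ A⇔B a? b? = trans (isYes≗does a?) (trans (does-⇔ A⇔B a? b?) (sym (isYes≗does b?)))

⌊⌋-×-dec : ∀ {a b} {A : Set a} {B : Set b} (a? : Dec A) (b? : Dec B) → ⌊ a? ×-dec b? ⌋ ≡ ⌊ a? ⌋ ∧ ⌊ b? ⌋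
⌊⌋-×-dec a? b? = trans (isYes≗does (a? ×-dec b?)) (sym (cong₂ _∧_ (isYes≗does a?) (isYes≗does b?)))

⌊⌋-true : ∀ {a} {A : Set a} (a? : Dec A) → A → ⌊ a? ⌋ ≡ true
⌊⌋-true a? a = trans (isYes≗does a?) (dec-true a? a)

⌊⌋-false : ∀ {a} {A : Set a} (a? : Dec A) → ¬ A → ⌊ a? ⌋ ≡ false
⌊⌋-false a? ¬a = trans (isYes≗does a?) (dec-false a? ¬a)

isAbove : ℤ → ℤ → Bool
isAbove l x = ⌊ l ℤ.≤? x ⌋

isAt : ℤ → ℤ → Bool
isAt t x = ⌊ x ℤ.≟ t ⌋

isAbove-⊓ : ∀ l x y → isAbove l (x ⊓ y) ≡ isAbove l x ∧ isAbove l y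
isAbove-⊓ l x y = trans (⌊⌋-⇔ glb⇔ (l ℤ.≤? x ⊓ y) (l ℤ.≤? x ×-dec l ℤ.≤? y))
                        (⌊⌋-×-dec (l ℤ.≤? x) (l ℤ.≤? y))
  where
  glb⇔ : l ℤ.≤ x ⊓ y ⇔ (l ℤ.≤ x × l ℤ.≤ y)
  glb⇔ = mk⇔ (λ l≤x⊓y → ℤ.≤-trans l≤x⊓y (ℤ.i⊓j≤i x y) , ℤ.≤-trans l≤x⊓y (ℤ.i⊓j≤j x y))
             (uncurry ℤ.⊓-glb)

isAbove-isAt : ∀ {l t} → l ℤ.≤ t → ∀ x → isAbove l x ∧ isAt t x ≡ isAt t x
isAbove-isAt {l} {t} l≤t x = trans (sym (⌊⌋-×-dec (l ℤ.≤? x) (x ℤ.≟ t))) (⌊⌋-⇔ at⇔ _ (x ℤ.≟ t))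
  where
  at⇔ : (l ℤ.≤ x × x ≡ t) ⇔ x ≡ t
  at⇔ = mk⇔ proj₂ (λ x≡t → subst (l ℤ.≤_) (sym x≡t) l≤t , x≡t)

+-cancelʳ-≤ : ∀ d {x y} → x ℤ.+ d ℤ.≤ y ℤ.+ d → x ℤ.≤ y
+-cancelʳ-≤ d {x} {y} le = subst₂ ℤ._≤_ (add-sub x d) (add-sub y d) (ℤ.+-monoˡ-≤ (ℤ.- d) le)
  where
  add-sub : ∀ x d → x ℤ.+ d ℤ.+ ℤ.- d ≡ x
  add-sub = ℤ.solve-∀

isAbove-+ : ∀ d l x → isAbove (l ℤ.+ d) (x ℤ.+ d) ≡ isAbove l x
isAbove-+ d l x = ⌊⌋-⇔ (mk⇔ (+-cancelʳ-≤ d) (ℤ.+-monoˡ-≤ d)) _ _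

isAt-+ : ∀ d t x → isAt (t ℤ.+ d) (x ℤ.+ d) ≡ isAt t x
isAt-+ d t x = ⌊⌋-⇔ (mk⇔ (+-cancelʳ-≡ d _ _) (cong (ℤ._+ d))) _ _

𝟙-isAt-* : ∀ t x (f : ℤ → ℕ) → 𝟙 (isAt t x) * f x ≡ 𝟙 (isAt t x) * f t
𝟙-isAt-* t x f with x ℤ.≟ t
... | yes refl = refl
... | no _     = refl

walkIn : (ℤ → Bool) → (ℤ → Bool) → ℤ → List Step → Bool
walkIn region target h []      = region h ∧ target h
walkIn region target h (s ∷ w) = region h ∧ walkIn region target (h ℤ.+ δ s) w

#walks : ℕ → (ℤ → Bool) → (ℤ → Bool) → ℤ → ℕ
#walks n region target h = Σwords n (λ w → 𝟙 (walkIn region target h w))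

#walks-suc : ∀ n g t h → #walks (suc n) g t h ≡ 𝟙 (g h) * Σsteps (λ s → #walks n g t (h ℤ.+ δ s))
#walks-suc n g t h = Σwords-suc-scaled n (𝟙 (g h)) _ _ (λ s w → 𝟙-∧ (g h) _)

walkIn-translate : ∀ d {g g′ t t′ : ℤ → Bool} →
                   (∀ x → g (x ℤ.+ d) ≡ g′ x) → (∀ x → t (x ℤ.+ d) ≡ t′ x) →
                   ∀ h w → walkIn g t (h ℤ.+ d) w ≡ walkIn g′ t′ h w
walkIn-translate d {g} {t = t} g≡ t≡ h []      = cong₂ _∧_ (g≡ h) (t≡ h)
walkIn-translate d {g} {t = t} g≡ t≡ h (s ∷ w) =
  cong₂ _∧_ (g≡ h) (trans (cong (λ y → walkIn g t y w) (right-comm h d (δ s)))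
                          (walkIn-translate d g≡ t≡ (h ℤ.+ δ s) w))
  where
  right-comm : ∀ x y z → x ℤ.+ y ℤ.+ z ≡ x ℤ.+ z ℤ.+ y
  right-comm = ℤ.solve-∀

#walks-translate : ∀ n d {g g′ t t′ : ℤ → Bool} {h h′} →
                   (∀ x → g (x ℤ.+ d) ≡ g′ x) → (∀ x → t (x ℤ.+ d) ≡ t′ x) →
                   h ℤ.+ d ≡ h′ → #walks n g t h′ ≡ #walks n g′ t′ h
#walks-translate n d g≡ t≡ refl = sum-map-cong (λ w → cong 𝟙 (walkIn-translate d g≡ t≡ _ w)) (words n)

-- X n h counts paths of length n from h that stay in g up to a marked step, taken from a height
-- satisfying c, after which the rest of the path is counted by e; cutting at the marked step
-- gives the convolution.
walks⋆-unique : ∀ (g c : ℤ → Bool) (e : ℕ → ℕ) (X : ℕ → ℤ → ℕ) → (∀ h → X 0 h ≡ 0) →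
                (∀ n h → X (suc n) h ≡ 𝟙 (g h) * (𝟙 (c h) * e n + Σsteps (λ s → X n (h ℤ.+ δ s)))) →
                ∀ n h → X n h ≡ ((λ a → #walks a g c h) ⋆ e) n
walks⋆-unique g c e X X-zero X-suc zero    h = X-zero h
walks⋆-unique g c e X X-zero X-suc (suc n) h = begin
  X (suc n) h
    ≡⟨ X-suc n h ⟩
  𝟙 (g h) * (𝟙 (c h) * e n + Σsteps (λ s → X n (h ℤ.+ δ s)))
    ≡⟨ cong (λ z → 𝟙 (g h) * (𝟙 (c h) * e n + z)) (Σsteps-cong (λ s → ih (h ℤ.+ δ s))) ⟩
  𝟙 (g h) * (𝟙 (c h) * e n + Σsteps (λ s → (W (h ℤ.+ δ s) ⋆ e) n))
    ≡⟨ cong (λ z → 𝟙 (g h) * (𝟙 (c h) * e n + z)) (⋆-Σsteps (λ s → W (h ℤ.+ δ s)) e n) ⟨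
  𝟙 (g h) * (𝟙 (c h) * e n + ((λ a → Σsteps (λ s → W (h ℤ.+ δ s) a)) ⋆ e) n)
    ≡⟨ distrib (𝟙 (g h)) (𝟙 (c h)) (e n) _ ⟩
  𝟙 (g h) * 𝟙 (c h) * e n + 𝟙 (g h) * ((λ a → Σsteps (λ s → W (h ℤ.+ δ s) a)) ⋆ e) n
    ≡⟨ cong₂ _+_ (cong (_* e n) (sym (trans (+-identityʳ _) (𝟙-∧ (g h) (c h)))))
                 (sym (trans (⋆-cong (λ a → #walks-suc a g c h) (λ _ → refl) n) (⋆-scaleˡ (𝟙 (g h)) _ e n))) ⟩
  W h 0 * e n + ((W h ∘ suc) ⋆ e) n
    ∎
  where
  ih : ∀ h → X n h ≡ ((λ a → #walks a g c h) ⋆ e) n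
  ih = walks⋆-unique g c e X X-zero X-suc n
  W : ℤ → ℕ → ℕ
  W h a = #walks a g c h
  distrib : ∀ a b x y → a * (b * x + y) ≡ a * b * x + a * y
  distrib = solve-∀

staysNonNeg-walkIn : ∀ t h w → ⌊ endHeight h w ℤ.≟ t ⌋ ∧ staysNonNeg h w ≡ walkIn (isAbove 0ℤ) (isAt t) h w
staysNonNeg-walkIn t h []      = ∧-comm (isAt t h) (isAbove 0ℤ h)
staysNonNeg-walkIn t h (s ∷ w) = trans (∧-leftComm (isAt t (endHeight (h ℤ.+ δ s) w)) (isAbove 0ℤ h) _)
                                       (cong (isAbove 0ℤ h ∧_) (staysNonNeg-walkIn t (h ℤ.+ δ s) w))

minHeight-walkIn : ∀ l t h w → ⌊ endHeight h w ℤ.≟ t ⌋ ∧ isAbove l (minHeight h w) ≡ walkIn (isAbove l) (isAt t) h w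
minHeight-walkIn l t h []      = ∧-comm (isAt t h) (isAbove l h)
minHeight-walkIn l t h (s ∷ w) = begin
  e ∧ isAbove l (h ⊓ minHeight (h ℤ.+ δ s) w)          ≡⟨ cong (e ∧_) (isAbove-⊓ l h _) ⟩
  e ∧ (isAbove l h ∧ isAbove l (minHeight (h ℤ.+ δ s) w)) ≡⟨ ∧-leftComm e (isAbove l h) _ ⟩
  isAbove l h ∧ (e ∧ isAbove l (minHeight (h ℤ.+ δ s) w))
    ≡⟨ cong (isAbove l h ∧_) (minHeight-walkIn l t (h ℤ.+ δ s) w) ⟩
  isAbove l h ∧ walkIn (isAbove l) (isAt t) (h ℤ.+ δ s) w ∎
  where
  e = isAt t (endHeight (h ℤ.+ δ s) w)

minHeight≤ : ∀ h w → minHeight h w ℤ.≤ h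
minHeight≤ h []      = ℤ.≤-refl
minHeight≤ h (s ∷ w) = ℤ.i⊓j≤i h _

isAt-⊓ : ∀ {m h} → m ℤ.< h → ∀ y → isAt m (h ⊓ y) ≡ isAt m y
isAt-⊓ {m} {h} m<h y = ⌊⌋-⇔ (mk⇔ to from) _ _
  where
  to : h ⊓ y ≡ m → y ≡ m
  to h⊓y≡m with ℤ.≤-total y h
  ... | inj₁ y≤h = trans (sym (ℤ.i≥j⇒i⊓j≡j y≤h)) h⊓y≡m
  ... | inj₂ h≤y = ⊥-elim (ℤ.<⇒≢ m<h (sym (trans (sym (ℤ.i≤j⇒i⊓j≡i h≤y)) h⊓y≡m)))
  from : y ≡ m → h ⊓ y ≡ m
  from refl = ℤ.i≥j⇒i⊓j≡j (ℤ.<⇒≤ m<h)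

isAt≡isAbove : ∀ {m y} → y ℤ.≤ m → isAt m y ≡ isAbove m y
isAt≡isAbove y≤m = ⌊⌋-⇔ (mk⇔ (λ y≡m → ℤ.≤-reflexive (sym y≡m)) (ℤ.≤-antisym y≤m)) _ _

allFlat : List Step → Bool
allFlat []      = true
allFlat (F ∷ w) = allFlat w
allFlat (U ∷ w) = false
allFlat (D ∷ w) = false

lastNonFlatIsUp-U : ∀ w → lastNonFlatIsUp (U ∷ w) ≡ lastNonFlatIsUp w ∨ allFlat w
lastNonFlatIsUp-U []      = refl
lastNonFlatIsUp-U (U ∷ w) = refl
lastNonFlatIsUp-U (D ∷ w) = refl
lastNonFlatIsUp-U (F ∷ w) = lastNonFlatIsUp-U w

allFlat⇒¬lastNonFlatIsUp : ∀ w → allFlat w ≡ true → lastNonFlatIsUp w ≡ false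
allFlat⇒¬lastNonFlatIsUp []      _    = refl
allFlat⇒¬lastNonFlatIsUp (F ∷ w) flat = allFlat⇒¬lastNonFlatIsUp w flat

allFlat⇒minHeight≡ : ∀ h w → allFlat w ≡ true → minHeight h w ≡ h
allFlat⇒minHeight≡ h []      _    = refl
allFlat⇒minHeight≡ h (F ∷ w) flat = begin
  h ⊓ minHeight (h ℤ.+ 0ℤ) w ≡⟨ cong (λ x → h ⊓ minHeight x w) (ℤ.+-identityʳ h) ⟩
  h ⊓ minHeight h w         ≡⟨ cong (h ⊓_) (allFlat⇒minHeight≡ h w flat) ⟩
  h ⊓ h                     ≡⟨ ℤ.⊓-idem h ⟩
  h                         ∎

Σwords-allFlat : ∀ n (f : List Step → ℕ) → Σwords n (λ w → 𝟙 (allFlat w) * f w) ≡ f (replicate n F)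
Σwords-allFlat zero    f = trans (+-identityʳ (1 * f [])) (*-identityˡ (f []))
Σwords-allFlat (suc n) f = begin
  Σwords (suc n) (λ w → 𝟙 (allFlat w) * f w)
    ≡⟨ Σwords-suc n _ ⟩
  Σwords n (const 0) + Σwords n (const 0) + Σwords n (λ w → 𝟙 (allFlat w) * f (F ∷ w))
    ≡⟨ cong₂ _+_ (cong₂ _+_ (sum-map-0 (words n)) (sum-map-0 (words n))) (Σwords-allFlat n (f ∘ (F ∷_))) ⟩
  f (replicate (suc n) F) ∎

walkIn-replicate-F : ∀ (g t : ℤ → Bool) h n → walkIn g t h (replicate n F) ≡ g h ∧ t h
walkIn-replicate-F g t h zero    = refl
walkIn-replicate-F g t h (suc n) = begin
  g h ∧ walkIn g t (h ℤ.+ 0ℤ) (replicate n F) ≡⟨ cong (λ x → g h ∧ walkIn g t x (replicate n F)) (ℤ.+-identityʳ h) ⟩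
  g h ∧ walkIn g t h (replicate n F)         ≡⟨ cong (g h ∧_) (walkIn-replicate-F g t h n) ⟩
  g h ∧ (g h ∧ t h)                          ≡⟨ ∧-assoc (g h) (g h) (t h) ⟨
  (g h ∧ g h) ∧ t h                          ≡⟨ cong (_∧ t h) (∧-idem (g h)) ⟩
  g h ∧ t h                                  ∎

𝟙-∧-∨-disjoint : ∀ a b c → (c ≡ true → b ≡ false) → 𝟙 (a ∧ (b ∨ c)) ≡ 𝟙 (a ∧ b) + 𝟙 c * 𝟙 a
𝟙-∧-∨-disjoint false b     true  _    = refl
𝟙-∧-∨-disjoint false b     false _    = refl
𝟙-∧-∨-disjoint true  true  true  c⇒¬b with () ← c⇒¬b refl
𝟙-∧-∨-disjoint true  true  false _    = refl
𝟙-∧-∨-disjoint true  false true  _    = refl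
𝟙-∧-∨-disjoint true  false false _    = refl

∧-∨-absorb : ∀ a b c → (c ≡ true → a ≡ false) → a ∧ (b ∨ c) ≡ a ∧ b
∧-∨-absorb a b false _    = cong (a ∧_) (∨-identityʳ b)
∧-∨-absorb a b true  c⇒¬a rewrite c⇒¬a refl = refl

-- Humps

module Humps (k : ℕ) where

  K : ℤ
  K = ℤ.+ k

  humpWeight : ℤ → List Step → ℕ
  humpWeight h w = 𝟙 (walkIn (isAbove 0ℤ) (isAt 0ℤ) h w) * humpsOfHeight K h w

  humpTail : ℤ → List Step → ℕ
  humpTail h w = 𝟙 (flatsThenDown w) * 𝟙 (walkIn (isAbove 0ℤ) (isAt 0ℤ) h w)

  HM≡Σwords-humpWeight : ∀ n → HM n k ≡ Σwords n (humpWeight 0ℤ)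
  HM≡Σwords-humpWeight n = trans (sum-map-filterᵇ isMotzkin (humpsOfHeight K 0ℤ) (words n))
    (sum-map-cong (λ w → cong (λ b → 𝟙 b * humpsOfHeight K 0ℤ w) (staysNonNeg-walkIn 0ℤ 0ℤ w)) (words n))

  humpWeight-U : ∀ h w → humpWeight h (U ∷ w) ≡
                 𝟙 (isAbove 0ℤ h) * (𝟙 (isAt K (h ℤ.+ 1ℤ)) * humpTail (h ℤ.+ 1ℤ) w + humpWeight (h ℤ.+ 1ℤ) w)
  humpWeight-U h w = begin
    𝟙 (a ∧ W) * (𝟙 (c ∧ f) + H)   ≡⟨ cong₂ (λ x y → x * (y + H)) (𝟙-∧ a W) (𝟙-∧ c f) ⟩
    𝟙 a * 𝟙 W * (𝟙 c * 𝟙 f + H)   ≡⟨ regroup (𝟙 a) (𝟙 W) (𝟙 c) (𝟙 f) H ⟩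
    𝟙 a * (𝟙 c * (𝟙 f * 𝟙 W) + 𝟙 W * H) ∎
    where
    a = isAbove 0ℤ h
    c = isAt K (h ℤ.+ 1ℤ)
    f = flatsThenDown w
    W = walkIn (isAbove 0ℤ) (isAt 0ℤ) (h ℤ.+ 1ℤ) w
    H = humpsOfHeight K (h ℤ.+ 1ℤ) w
    regroup : ∀ a W c f H → a * W * (c * f + H) ≡ a * (c * (f * W) + W * H)
    regroup = solve-∀

  Σwords-humpWeight-suc : ∀ n h → Σwords (suc n) (humpWeight h) ≡
    𝟙 (isAbove 0ℤ h) * (𝟙 (isAt K (h ℤ.+ 1ℤ)) * Σwords n (humpTail K)
                        + Σsteps (λ s → Σwords n (humpWeight (h ℤ.+ δ s))))
  Σwords-humpWeight-suc n h = trans (Σwords-suc-scaled n (𝟙 (isAbove 0ℤ h)) (humpWeight h) φ first-step)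
                                    (cong (𝟙 (isAbove 0ℤ h) *_) split-U)
    where
    φ : Step → List Step → ℕ
    φ U w = 𝟙 (isAt K (h ℤ.+ 1ℤ)) * humpTail (h ℤ.+ 1ℤ) w + humpWeight (h ℤ.+ 1ℤ) w
    φ s w = humpWeight (h ℤ.+ δ s) w
    first-step : ∀ s w → humpWeight h (s ∷ w) ≡ 𝟙 (isAbove 0ℤ h) * φ s w
    first-step U w = humpWeight-U h w
    first-step D w = 𝟙-∧-* (isAbove 0ℤ h) _ _
    first-step F w = 𝟙-∧-* (isAbove 0ℤ h) _ _
    c = 𝟙 (isAt K (h ℤ.+ 1ℤ))
    X : ℤ → ℕ
    X x = Σwords n (humpWeight x)
    split-U : Σsteps (λ s → Σwords n (φ s)) ≡ c * Σwords n (humpTail K) + Σsteps (λ s → X (h ℤ.+ δ s))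
    split-U = begin
      Σwords n (φ U) + X (h ℤ.+ δ D) + X (h ℤ.+ δ F)
        ≡⟨ cong (λ z → z + X (h ℤ.+ δ D) + X (h ℤ.+ δ F)) (sum-map-+ _ _ (words n)) ⟩
      Σwords n (λ w → c * humpTail (h ℤ.+ 1ℤ) w) + X (h ℤ.+ 1ℤ) + X (h ℤ.+ δ D) + X (h ℤ.+ δ F)
        ≡⟨ cong (λ z → z + X (h ℤ.+ 1ℤ) + X (h ℤ.+ δ D) + X (h ℤ.+ δ F)) (sum-map-*ˡ c _ (words n)) ⟩
      c * Σwords n (humpTail (h ℤ.+ 1ℤ)) + X (h ℤ.+ 1ℤ) + X (h ℤ.+ δ D) + X (h ℤ.+ δ F)
        ≡⟨ cong (λ z → z + X (h ℤ.+ 1ℤ) + X (h ℤ.+ δ D) + X (h ℤ.+ δ F))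
                (𝟙-isAt-* K (h ℤ.+ 1ℤ) (λ x → Σwords n (humpTail x))) ⟩
      c * Σwords n (humpTail K) + X (h ℤ.+ 1ℤ) + X (h ℤ.+ δ D) + X (h ℤ.+ δ F)
        ≡⟨ assoc4 (c * Σwords n (humpTail K)) (X (h ℤ.+ 1ℤ)) (X (h ℤ.+ δ D)) (X (h ℤ.+ δ F)) ⟩
      c * Σwords n (humpTail K) + Σsteps (λ s → X (h ℤ.+ δ s)) ∎
      where
      assoc4 : ∀ a b c d → a + b + c + d ≡ a + (b + c + d)
      assoc4 = solve-∀

  toHump : ℕ → ℕ
  toHump a = #walks a (isAbove 0ℤ) (λ x → isAt K (x ℤ.+ 1ℤ)) 0ℤ

  fromHump : ℕ → ℕ
  fromHump b = #walks b (isAbove 0ℤ) (isAt 0ℤ) (K ℤ.+ δ D)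

  Σwords-humpTail : ∀ n → Σwords n (humpTail K) ≡ (fromHump ⋆ const 1) n
  Σwords-humpTail = partialSums-unique (λ n → Σwords n (humpTail K)) fromHump refl tail-suc
    where
    tail-suc : ∀ n → Σwords (suc n) (humpTail K) ≡ fromHump n + Σwords n (humpTail K)
    tail-suc n = begin
      Σwords (suc n) (humpTail K)
        ≡⟨ Σwords-suc n (humpTail K) ⟩
      Σwords n (const 0) + Σwords n (λ w → 𝟙 (walkIn (isAbove 0ℤ) (isAt 0ℤ) (K ℤ.+ δ D) w) + 0)
                         + Σwords n (λ w → 𝟙 (flatsThenDown w) * 𝟙 (walkIn (isAbove 0ℤ) (isAt 0ℤ) (K ℤ.+ δ F) w))
        ≡⟨ cong₂ _+_ (cong₂ _+_ (sum-map-0 (words n)) (sum-map-cong (λ w → +-identityʳ _) (words n)))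
                     (sum-map-cong (λ w → cong (λ x → humpTail x w) (ℤ.+-identityʳ K)) (words n)) ⟩
      fromHump n + Σwords n (humpTail K) ∎

  Σwords-humpWeight : ∀ n → Σwords n (humpWeight 0ℤ) ≡ (toHump ⋆ (fromHump ⋆ const 1)) n
  Σwords-humpWeight n = trans
    (walks⋆-unique (isAbove 0ℤ) (λ x → isAt K (x ℤ.+ 1ℤ)) (λ n → Σwords n (humpTail K))
                   (λ n h → Σwords n (humpWeight h))
                   (λ h → cong (_+ 0) (*-zeroʳ (𝟙 (walkIn (isAbove 0ℤ) (isAt 0ℤ) h [])))) Σwords-humpWeight-suc n 0ℤ)
    (⋆-cong (λ _ → refl) Σwords-humpTail n)

-- Lowest points

module LowestPoint (m : ℤ) (m<0 : m ℤ.< 0ℤ) where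

  aboveWeight : ℤ → List Step → ℕ
  aboveWeight h w = 𝟙 (walkIn (isAbove m) (isAt 0ℤ) h w ∧ lastNonFlatIsUp w)

  lowestWeight : ℤ → List Step → ℕ
  lowestWeight h w = 𝟙 (⌊ endHeight h w ℤ.≟ 0ℤ ⌋ ∧ isAt m (minHeight h w) ∧ lastNonFlatIsUp w)

  aboveWeight-U : ∀ h w → aboveWeight h (U ∷ w) ≡
    𝟙 (isAbove m h) * (aboveWeight (h ℤ.+ 1ℤ) w + 𝟙 (allFlat w) * 𝟙 (walkIn (isAbove m) (isAt 0ℤ) (h ℤ.+ 1ℤ) w))
  aboveWeight-U h w = begin
    𝟙 ((a ∧ W) ∧ lastNonFlatIsUp (U ∷ w)) ≡⟨ cong (λ b → 𝟙 ((a ∧ W) ∧ b)) (lastNonFlatIsUp-U w) ⟩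
    𝟙 ((a ∧ W) ∧ (L ∨ allFlat w))         ≡⟨ trans (cong 𝟙 (∧-assoc a W _)) (𝟙-∧ a _) ⟩
    𝟙 a * 𝟙 (W ∧ (L ∨ allFlat w))
      ≡⟨ cong (𝟙 a *_) (𝟙-∧-∨-disjoint W L (allFlat w) (allFlat⇒¬lastNonFlatIsUp w)) ⟩
    𝟙 a * (𝟙 (W ∧ L) + 𝟙 (allFlat w) * 𝟙 W) ∎
    where
    a = isAbove m h
    W = walkIn (isAbove m) (isAt 0ℤ) (h ℤ.+ 1ℤ) w
    L = lastNonFlatIsUp w

  Σwords-aboveWeight-suc : ∀ n h → Σwords (suc n) (aboveWeight h) ≡
    𝟙 (isAbove m h) * (𝟙 (isAt 0ℤ (h ℤ.+ 1ℤ)) * 1 + Σsteps (λ s → Σwords n (aboveWeight (h ℤ.+ δ s))))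
  Σwords-aboveWeight-suc n h = trans (Σwords-suc-scaled n (𝟙 (isAbove m h)) (aboveWeight h) φ first-step)
                                     (cong (𝟙 (isAbove m h) *_) split-U)
    where
    φ : Step → List Step → ℕ
    φ U w = aboveWeight (h ℤ.+ 1ℤ) w + 𝟙 (allFlat w) * 𝟙 (walkIn (isAbove m) (isAt 0ℤ) (h ℤ.+ 1ℤ) w)
    φ s w = aboveWeight (h ℤ.+ δ s) w
    first-step : ∀ s w → aboveWeight h (s ∷ w) ≡ 𝟙 (isAbove m h) * φ s w
    first-step U w = aboveWeight-U h w
    first-step D w = trans (cong 𝟙 (∧-assoc (isAbove m h) _ _)) (𝟙-∧ (isAbove m h) _)
    first-step F w = trans (cong 𝟙 (∧-assoc (isAbove m h) _ _)) (𝟙-∧ (isAbove m h) _)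
    X : ℤ → ℕ
    X x = Σwords n (aboveWeight x)
    c = 𝟙 (isAt 0ℤ (h ℤ.+ 1ℤ))
    flat-end : Σwords n (λ w → 𝟙 (allFlat w) * 𝟙 (walkIn (isAbove m) (isAt 0ℤ) (h ℤ.+ 1ℤ) w)) ≡ c
    flat-end = begin
      _                                                ≡⟨ Σwords-allFlat n _ ⟩
      𝟙 (walkIn (isAbove m) (isAt 0ℤ) (h ℤ.+ 1ℤ) (replicate n F))
                                                       ≡⟨ cong 𝟙 (walkIn-replicate-F _ _ (h ℤ.+ 1ℤ) n) ⟩
      𝟙 (isAbove m (h ℤ.+ 1ℤ) ∧ isAt 0ℤ (h ℤ.+ 1ℤ)) ≡⟨ cong 𝟙 (isAbove-isAt (ℤ.<⇒≤ m<0) (h ℤ.+ 1ℤ)) ⟩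
      c                                                ∎
    split-U : Σsteps (λ s → Σwords n (φ s)) ≡ c * 1 + Σsteps (λ s → X (h ℤ.+ δ s))
    split-U = begin
      Σwords n (φ U) + X (h ℤ.+ δ D) + X (h ℤ.+ δ F)
        ≡⟨ cong (λ z → z + X (h ℤ.+ δ D) + X (h ℤ.+ δ F))
                (trans (sum-map-+ _ _ (words n)) (cong (X (h ℤ.+ 1ℤ) +_) flat-end)) ⟩
      X (h ℤ.+ 1ℤ) + c + X (h ℤ.+ δ D) + X (h ℤ.+ δ F)
        ≡⟨ regroup (X (h ℤ.+ 1ℤ)) c (X (h ℤ.+ δ D)) (X (h ℤ.+ δ F)) ⟩
      c * 1 + Σsteps (λ s → X (h ℤ.+ δ s)) ∎
      where
      regroup : ∀ a c b d → a + c + b + d ≡ c * 1 + (a + b + d)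
      regroup = solve-∀

  fromMinimum : ℕ → ℕ
  fromMinimum a = #walks a (isAbove m) (λ x → isAt 0ℤ (x ℤ.+ 1ℤ)) m

  Σwords-aboveWeight : ∀ n → Σwords n (aboveWeight m) ≡ (fromMinimum ⋆ const 1) n
  Σwords-aboveWeight n =
    walks⋆-unique (isAbove m) (λ x → isAt 0ℤ (x ℤ.+ 1ℤ)) (const 1) (λ n h → Σwords n (aboveWeight h))
                  (λ h → cong (λ b → 𝟙 b + 0) (∧-zeroʳ _)) Σwords-aboveWeight-suc n m

  lowestWeight-[] : ∀ h → lowestWeight h [] ≡ 0
  lowestWeight-[] h = cong 𝟙 (trans (cong (isAt 0ℤ h ∧_) (∧-zeroʳ (isAt m h))) (∧-zeroʳ (isAt 0ℤ h)))

  lowestWeight-∷ : ∀ s h w → m ℤ.< h → lowestWeight h (s ∷ w) ≡ lowestWeight (h ℤ.+ δ s) w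
  lowestWeight-∷ U h w m<h = begin
    𝟙 (e ∧ isAt m (h ⊓ y) ∧ lastNonFlatIsUp (U ∷ w))
      ≡⟨ cong₂ (λ a b → 𝟙 (e ∧ a ∧ b)) (isAt-⊓ m<h y) (lastNonFlatIsUp-U w) ⟩
    𝟙 (e ∧ isAt m y ∧ (lastNonFlatIsUp w ∨ allFlat w))
      ≡⟨ cong (λ b → 𝟙 (e ∧ b)) (∧-∨-absorb (isAt m y) _ (allFlat w) flat⇒¬lowest) ⟩
    𝟙 (e ∧ isAt m y ∧ lastNonFlatIsUp w)
      ∎
    where
    e = isAt 0ℤ (endHeight (h ℤ.+ 1ℤ) w)
    y = minHeight (h ℤ.+ 1ℤ) w
    flat⇒¬lowest : allFlat w ≡ true → isAt m y ≡ false
    flat⇒¬lowest flat = trans (cong (isAt m) (allFlat⇒minHeight≡ (h ℤ.+ 1ℤ) w flat))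
      (⌊⌋-false (h ℤ.+ 1ℤ ℤ.≟ m) (λ h+1≡m → ℤ.<⇒≢ (ℤ.<-≤-trans m<h (ℤ.i≤i+j h 1ℤ)) (sym h+1≡m)))
  lowestWeight-∷ D h w m<h = cong (λ a → 𝟙 (isAt 0ℤ (endHeight (h ℤ.+ δ D) w) ∧ a ∧ lastNonFlatIsUp w)) (isAt-⊓ m<h _)
  lowestWeight-∷ F h w m<h = cong (λ a → 𝟙 (isAt 0ℤ (endHeight (h ℤ.+ δ F) w) ∧ a ∧ lastNonFlatIsUp w)) (isAt-⊓ m<h _)

  lowestWeight-m : ∀ w → lowestWeight m w ≡ aboveWeight m w
  lowestWeight-m w = cong 𝟙 (begin
    e ∧ isAt m y ∧ L      ≡⟨ cong (λ b → e ∧ b ∧ L) (isAt≡isAbove (minHeight≤ m w)) ⟩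
    e ∧ isAbove m y ∧ L   ≡⟨ ∧-assoc e _ L ⟨
    (e ∧ isAbove m y) ∧ L ≡⟨ cong (_∧ L) (minHeight-walkIn m 0ℤ m w) ⟩
    walkIn (isAbove m) (isAt 0ℤ) m w ∧ L ∎)
    where
    e = isAt 0ℤ (endHeight m w)
    y = minHeight m w
    L = lastNonFlatIsUp w

  m+1≤⇒m< : ∀ {h} → m ℤ.+ 1ℤ ℤ.≤ h → m ℤ.< h
  m+1≤⇒m< {h} m+1≤h = ℤ.suc[i]≤j⇒i<j (subst (ℤ._≤ h) (ℤ.+-comm m 1ℤ) m+1≤h)

  m<⇒m+1≤ : ∀ {h} → m ℤ.< h → m ℤ.+ 1ℤ ℤ.≤ h
  m<⇒m+1≤ {h} m<h = subst (ℤ._≤ h) (ℤ.+-comm 1ℤ m) (ℤ.i<j⇒suc[i]≤j m<h)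

  -- Discarding the starting heights ≤ m makes the first visit to m a marked step: the D step from m + 1.
  lowestAbove : ℕ → ℤ → ℕ
  lowestAbove n h = 𝟙 (isAbove (m ℤ.+ 1ℤ) h) * Σwords n (lowestWeight h)

  lowestAbove-zero : ∀ h → lowestAbove 0 h ≡ 0
  lowestAbove-zero h = trans (cong (λ x → 𝟙 (isAbove (m ℤ.+ 1ℤ) h) * (x + 0)) (lowestWeight-[] h))
                             (*-zeroʳ (𝟙 (isAbove (m ℤ.+ 1ℤ) h)))

  lowestAbove≡Σwords : ∀ n {h} → m ℤ.< h → lowestAbove n h ≡ Σwords n (lowestWeight h)
  lowestAbove≡Σwords n {h} m<h =
    trans (cong (λ b → 𝟙 b * Σwords n (lowestWeight h)) (⌊⌋-true (m ℤ.+ 1ℤ ℤ.≤? h) (m<⇒m+1≤ m<h))) (*-identityˡ _)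

  Σwords-lowestWeight-split : ∀ n h → m ℤ.≤ h →
                              Σwords n (lowestWeight h) ≡ 𝟙 (isAt m h) * Σwords n (aboveWeight m) + lowestAbove n h
  Σwords-lowestWeight-split n h m≤h with h ℤ.≟ m
  ... | yes refl = begin
    Σwords n (lowestWeight m) ≡⟨ sum-map-cong lowestWeight-m (words n) ⟩
    A                         ≡⟨ trans (+-identityʳ _) (*-identityˡ _) ⟨
    1 * A + 0                 ≡⟨ cong (λ b → 1 * A + 𝟙 b * Σwords n (lowestWeight m)) m+1≰m ⟨
    1 * A + lowestAbove n m   ∎
    where
    A = Σwords n (aboveWeight m)
    m+1≰m : isAbove (m ℤ.+ 1ℤ) m ≡ false
    m+1≰m = ⌊⌋-false (m ℤ.+ 1ℤ ℤ.≤? m) (λ m+1≤m → ℤ.<-irrefl refl (m+1≤⇒m< m+1≤m))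
  ... | no h≢m = sym (lowestAbove≡Σwords n (ℤ.≤∧≢⇒< m≤h (h≢m ∘ sym)))

  lowestAbove-suc : ∀ n h → lowestAbove (suc n) h ≡
    𝟙 (isAbove (m ℤ.+ 1ℤ) h) * (𝟙 (isAt m (h ℤ.+ δ D)) * Σwords n (aboveWeight m)
                                + Σsteps (λ s → lowestAbove n (h ℤ.+ δ s)))
  lowestAbove-suc n h with m ℤ.+ 1ℤ ℤ.≤? h
  ... | no _      = refl
  ... | yes m+1≤h = cong (1 *_) (begin
    Σwords (suc n) (lowestWeight h)
      ≡⟨ Σwords-suc n (lowestWeight h) ⟩
    Σsteps (λ s → Σwords n (lowestWeight h ∘ (s ∷_)))
      ≡⟨ Σsteps-cong (λ s → sum-map-cong (λ w → lowestWeight-∷ s h w m<h) (words n)) ⟩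
    Λ (h ℤ.+ 1ℤ) + Λ (h ℤ.+ δ D) + Λ (h ℤ.+ δ F)
      ≡⟨ cong₂ _+_ (cong₂ _+_ (sym (lowestAbove≡Σwords n (ℤ.<-≤-trans m<h (ℤ.i≤i+j h 1ℤ))))
                              (Σwords-lowestWeight-split n (h ℤ.+ δ D) m≤h-1))
                   (sym (lowestAbove≡Σwords n (subst (m ℤ.<_) (sym (ℤ.+-identityʳ h)) m<h))) ⟩
    lowestAbove n (h ℤ.+ 1ℤ) + (c * A + lowestAbove n (h ℤ.+ δ D)) + lowestAbove n (h ℤ.+ δ F)
      ≡⟨ regroup (lowestAbove n (h ℤ.+ 1ℤ)) (c * A) _ _ ⟩
    c * A + Σsteps (λ s → lowestAbove n (h ℤ.+ δ s)) ∎)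
    where
    Λ : ℤ → ℕ
    Λ x = Σwords n (lowestWeight x)
    A = Σwords n (aboveWeight m)
    c = 𝟙 (isAt m (h ℤ.+ δ D))
    m<h : m ℤ.< h
    m<h = m+1≤⇒m< m+1≤h
    m≤h-1 : m ℤ.≤ h ℤ.+ δ D
    m≤h-1 = subst (ℤ._≤ h ℤ.+ δ D) (add-sub m) (ℤ.+-monoˡ-≤ ℤ.-1ℤ m+1≤h)
      where
      add-sub : ∀ x → x ℤ.+ 1ℤ ℤ.+ ℤ.-1ℤ ≡ x
      add-sub = ℤ.solve-∀
    regroup : ∀ a b d f → a + (b + d) + f ≡ b + (a + d + f)
    regroup = solve-∀

  toMinimum : ℕ → ℕ
  toMinimum c = #walks c (isAbove (m ℤ.+ 1ℤ)) (λ x → isAt m (x ℤ.+ δ D)) 0ℤ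

  Σwords-lowestWeight : ∀ n → Σwords n (lowestWeight 0ℤ) ≡ (toMinimum ⋆ (fromMinimum ⋆ const 1)) n
  Σwords-lowestWeight n = begin
    Σwords n (lowestWeight 0ℤ)
      ≡⟨ lowestAbove≡Σwords n m<0 ⟨
    lowestAbove n 0ℤ
      ≡⟨ walks⋆-unique (isAbove (m ℤ.+ 1ℤ)) (λ x → isAt m (x ℤ.+ δ D)) (λ n → Σwords n (aboveWeight m)) lowestAbove
                       lowestAbove-zero lowestAbove-suc n 0ℤ ⟩
    (toMinimum ⋆ (λ r → Σwords r (aboveWeight m))) n
      ≡⟨ ⋆-cong (λ _ → refl) Σwords-aboveWeight n ⟩
    (toMinimum ⋆ (fromMinimum ⋆ const 1)) n ∎

module _ (k : ℕ) where
  open Humps (suc k)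
  open LowestPoint (ℤ.- K) ℤ.-<+

  toMinimum≗fromHump : toMinimum ≗ fromHump
  toMinimum≗fromHump c = #walks-translate c (ℤ.- K ℤ.+ 1ℤ) region≡ target≡ (shift K)
    where
    region≡ : ∀ x → isAbove (ℤ.- K ℤ.+ 1ℤ) (x ℤ.+ (ℤ.- K ℤ.+ 1ℤ)) ≡ isAbove 0ℤ x
    region≡ x = trans (cong (λ l → isAbove l (x ℤ.+ (ℤ.- K ℤ.+ 1ℤ))) (sym (ℤ.+-identityˡ _))) (isAbove-+ _ 0ℤ x)
    target≡ : ∀ x → isAt (ℤ.- K) (x ℤ.+ (ℤ.- K ℤ.+ 1ℤ) ℤ.+ δ D) ≡ isAt 0ℤ x
    target≡ x = trans (cong₂ isAt (sym (ℤ.+-identityˡ (ℤ.- K))) (cancel x (ℤ.- K))) (isAt-+ (ℤ.- K) 0ℤ x)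
      where
      cancel : ∀ x m → x ℤ.+ (m ℤ.+ 1ℤ) ℤ.+ ℤ.-1ℤ ≡ x ℤ.+ m
      cancel = ℤ.solve-∀
    shift : ∀ K → K ℤ.+ ℤ.-1ℤ ℤ.+ (ℤ.- K ℤ.+ 1ℤ) ≡ 0ℤ
    shift = ℤ.solve-∀

  fromMinimum≗toHump : fromMinimum ≗ toHump
  fromMinimum≗toHump a = #walks-translate a (ℤ.- K) region≡ target≡ (ℤ.+-identityˡ (ℤ.- K))
    where
    region≡ : ∀ x → isAbove (ℤ.- K) (x ℤ.+ ℤ.- K) ≡ isAbove 0ℤ x
    region≡ x = trans (cong (λ l → isAbove l (x ℤ.+ ℤ.- K)) (sym (ℤ.+-identityˡ (ℤ.- K)))) (isAbove-+ (ℤ.- K) 0ℤ x)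
    target≡ : ∀ x → isAt 0ℤ (x ℤ.+ ℤ.- K ℤ.+ 1ℤ) ≡ isAt K (x ℤ.+ 1ℤ)
    target≡ x = trans (cong₂ isAt (sym (ℤ.+-inverseʳ K)) (right-comm x (ℤ.- K) 1ℤ)) (isAt-+ (ℤ.- K) K (x ℤ.+ 1ℤ))
      where
      right-comm : ∀ x y z → x ℤ.+ y ℤ.+ z ≡ x ℤ.+ z ℤ.+ y
      right-comm = ℤ.solve-∀

mainTheorem3 : (n k : ℕ) → 2 ≤ n → 1 ≤ k → HM n k ≡ SM n k
mainTheorem3 n zero    _ ()
mainTheorem3 n (suc k) _ _ = begin
  HM n (suc k)                            ≡⟨ HM≡Σwords-humpWeight n ⟩
  Σwords n (humpWeight 0ℤ)                ≡⟨ Σwords-humpWeight n ⟩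
  (toHump ⋆ (fromHump ⋆ const 1)) n       ≡⟨ ⋆-leftComm toHump fromHump (const 1) n ⟩
  (fromHump ⋆ (toHump ⋆ const 1)) n       ≡⟨ ⋆-cong (toMinimum≗fromHump k) (⋆-cong (fromMinimum≗toHump k) λ _ → refl) n ⟨
  (toMinimum ⋆ (fromMinimum ⋆ const 1)) n ≡⟨ Σwords-lowestWeight n ⟨
  Σwords n (lowestWeight 0ℤ)              ≡⟨ length-filterᵇ _ (words n) ⟨
  SM n (suc k)                            ∎
  where
  open Humps (suc k)
  open LowestPoint (ℤ.- K) ℤ.-<+
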